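{- Let $G$ be a graph and let $a, r, k$ be positive integers. Then $\sigma(G,ar,ak) \geq \sigma(G,r,k)$.
   Context: Graphs are simple and undirected and may be infinite. For a graph $G$ and positive integers $r,s,k$, the game "Revolutionaries and Spies" $\mathcal{G}(G,r,s,k)$ is played between a team of $r$ revolutionaries and a team of $s$ spies with perfect information. In round $0$, each revolutionary chooses a vertex of $G$ as its position, and then each spy does the same; any number of agents may occupy the same vertex at any time. In each round $i \ge 1$, first every revolutionary simultaneously either stays at its vertex or moves to an adjacent vertex, and then every spy does the same. A meeting of size $k$ at a vertex $v$ means at least $k$ revolutionaries are at $v$; it is guarded if at least one spy is at $v$. The revolutionaries win if at the end of some round (after the spies have moved in that round) there is an unguarded meeting of size $k$; otherwise the spies win. $\sigma(G,r,k)$ denotes the minimum positive integer $s$ such that the spies have a winning strategy in $\mathcal{G}(G,r,s,k)$. -}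

module Defs where

open import Data.Nat using (ℕ; zero; suc; _≤_; _<_; _*_)
open import Data.Fin using (Fin; toℕ)
open import Data.Product using (Σ; ∃; _×_; _,_)
open import Data.Sum using (_⊎_)
open import Data.Empty using (⊥)
open import Relation.Nullary using (¬_)
open import Relation.Binary.PropositionalEquality using (_≡_)
open import Function.Definitions using (Injective)

record Graph : Set₁ where
  field
    V      : Set
    Adj    : V → V → Set
    sym    : ∀ {x y} → Adj x y → Adj y x
    irrefl : ∀ {x} → ¬ Adj x x
open Graph public

module _ (G : Graph) where

  Step : V G → V G → Set
  Step x y = x ≡ y ⊎ Adj G x y

  Conf : ℕ → Set
  Conf n = Fin n → V G

  Meeting : {r : ℕ} → ℕ → Conf r → V G → Set
  Meeting {r} k R v =
    Σ (Fin k → Fin r) λ f → Injective _≡_ _≡_ f × (∀ i → R (f i) ≡ v)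

  Guarded : {s : ℕ} → Conf s → V G → Set
  Guarded S v = ∃ λ j → S j ≡ v

  UnguardedMeeting : {r s : ℕ} → ℕ → Conf r → Conf s → Set
  UnguardedMeeting k R S = ∃ λ v → Meeting k R v × ¬ Guarded S v

  -- A spy strategy: in round n the spies see the revolutionaries' positions
  -- in rounds 0..n and their own positions in rounds 0..n-1
  -- (perfect information) and choose their positions for round n.
  SpyStrategy : ℕ → ℕ → Set
  SpyStrategy r s = (n : ℕ) → (Fin (suc n) → Conf r) → (Fin n → Conf s) → Conf s

  -- A play: R n / S n are the positions at the end of round n.
  LegalRevs : {r : ℕ} → (ℕ → Conf r) → Set
  LegalRevs R = ∀ n i → Step (R n i) (R (suc n) i)

  LegalSpies : {s : ℕ} → (ℕ → Conf s) → Set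
  LegalSpies S = ∀ n j → Step (S n j) (S (suc n) j)

  FollowsStrategy : {r s : ℕ} → SpyStrategy r s → (ℕ → Conf r) → (ℕ → Conf s) → Set
  FollowsStrategy st R S = ∀ n → S n ≡ st n (λ i → R (toℕ i)) (λ i → S (toℕ i))

  SpiesWin : ℕ → ℕ → ℕ → Set
  SpiesWin r s k =
    Σ (SpyStrategy r s) λ st →
      ∀ (R : ℕ → Conf r) (S : ℕ → Conf s) →
        LegalRevs R → FollowsStrategy st R S →
        LegalSpies S × (∀ n → ¬ UnguardedMeeting k (R n) (S n))

  IsSigma : ℕ → ℕ → ℕ → Set
  IsSigma r k s =
    1 ≤ s × SpiesWin r s k × (∀ s' → 1 ≤ s' → s' < s → ¬ SpiesWin r s' k)

module Submission where

-- Idea: a winning spy strategy against a·r revolutionaries and meetings of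
-- size a·k also wins against r revolutionaries and meetings of size k.
-- The spies imagine every real revolutionary as a bundle of a "copies"
-- standing on the same vertex, and answer the imagined a·r revolutionaries.
--   * The copies move legally whenever the real revolutionaries do.
--   * A meeting of k real revolutionaries at v is a meeting of a·k copies
--     at v, with the same spies present; so an unguarded real meeting would
--     be an unguarded imagined one, which the strategy never allows.
-- Hence the spies win G(G,r,s,k) whenever they win G(G,a·r,s,a·k); taking
-- s = σ(G,a·r,a·k) and using the minimality of σ(G,r,k) gives the theorem.
-- Agents of the imagined game are indexed by Fin (a * r) ≅ Fin a × Fin r
-- (Data.Fin's combine / remQuot); copy (q , i) follows revolutionary i.

open import Defs
open import Data.Nat using (ℕ; _≤_; _≥_; _*_)
open import Data.Nat.Properties using (≮⇒≥)
open import Data.Fin using (Fin; combine; remQuot; quotient; remainder)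
open import Data.Fin.Properties using (remQuot-combine; combine-remQuot; combine-injective)
open import Data.Product using (_×_; _,_; proj₁; proj₂)
open import Relation.Binary.PropositionalEquality
  using (_≡_; trans; cong; cong₂; module ≡-Reasoning)
open import Function.Definitions using (Injective)
open import Relation.Nullary using (¬_)

quotient-remainder-injective : ∀ {a k} {x y : Fin (a * k)} →
  quotient {a} k x ≡ quotient {a} k y → remainder {a} k x ≡ remainder {a} k y →
  x ≡ y
quotient-remainder-injective {a} {k} {x} {y} q≡ r≡ = begin
  x                                               ≡⟨ combine-remQuot {a} k x ⟨
  combine (quotient {a} k x) (remainder {a} k x)  ≡⟨ cong₂ combine q≡ r≡ ⟩
  combine (quotient {a} k y) (remainder {a} k y)  ≡⟨ combine-remQuot {a} k y ⟩
  y                                               ∎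
  where open ≡-Reasoning

remainder-combine : ∀ {a r} (q : Fin a) (i : Fin r) → remainder {a} r (combine q i) ≡ i
remainder-combine q i = cong proj₂ (remQuot-combine q i)

module _ (G : Graph) where

  copies : ∀ a {r} → Conf G r → Conf G (a * r)
  copies a {r} R i = R (remainder {a} r i)

  copies-legal : ∀ a {r} (R : ℕ → Conf G r) →
    LegalRevs G R → LegalRevs G (λ n → copies a (R n))
  copies-legal a {r} R legal n i = legal n (remainder {a} r i)

  copies-meeting : ∀ a {r k} (R : Conf G r) (v : V G) →
    Meeting G k R v → Meeting G (a * k) (copies a R) v
  copies-meeting a {r} {k} R v (f , f-injective , f-at-v) = g , g-injective , g-at-v
    where
    g : Fin (a * k) → Fin (a * r)
    g x = combine (quotient {a} k x) (f (remainder {a} k x))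

    g-at-v : ∀ x → copies a R (g x) ≡ v
    g-at-v x = trans (cong R (remainder-combine (quotient {a} k x) (f (remainder {a} k x))))
                     (f-at-v (remainder {a} k x))

    g-injective : Injective _≡_ _≡_ g
    g-injective {x} {y} gx≡gy =
      quotient-remainder-injective {a} {k} (proj₁ parts) (f-injective (proj₂ parts))
      where
      parts = combine-injective (quotient {a} k x) (f (remainder {a} k x))
                                (quotient {a} k y) (f (remainder {a} k y)) gx≡gy

  spiesWin-split : ∀ a {r s k} → SpiesWin G (a * r) s (a * k) → SpiesWin G r s k
  spiesWin-split a {r} {s} {k} (strategy , wins) = strategy′ , wins′
    where
    strategy′ : SpyStrategy G r s
    strategy′ n history spies = strategy n (λ t → copies a (history t)) spies

    wins′ : ∀ (R : ℕ → Conf G r) (S : ℕ → Conf G s) →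
      LegalRevs G R → FollowsStrategy G strategy′ R S →
      LegalSpies G S × (∀ n → ¬ UnguardedMeeting G k (R n) (S n))
    wins′ R S legal follows = spies-legal , no-unguarded
      where
      imagined = wins (λ n → copies a (R n)) S (copies-legal a R legal) follows
      spies-legal = proj₁ imagined
      no-unguarded : ∀ n → ¬ UnguardedMeeting G k (R n) (S n)
      no-unguarded n (v , meeting , unguarded) =
        proj₂ imagined n (v , copies-meeting a (R n) v meeting , unguarded)

  sigma-least : ∀ {r k σ s} → IsSigma G r k σ → 1 ≤ s → SpiesWin G r s k → σ ≤ s
  sigma-least (_ , _ , minimal) 1≤s win = ≮⇒≥ λ s<σ → minimal _ 1≤s s<σ win

mainTheorem4 : (G : Graph) (a r k : ℕ) → 1 ≤ a → 1 ≤ r → 1 ≤ k →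
    (σ₁ σ₂ : ℕ) → IsSigma G (a * r) (a * k) σ₁ → IsSigma G r k σ₂ →
    σ₁ ≥ σ₂
mainTheorem4 G a r k _ _ _ σ₁ σ₂ (1≤σ₁ , σ₁-wins , _) σ₂-sigma =
  sigma-least G σ₂-sigma 1≤σ₁ (spiesWin-split G a σ₁-wins)
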